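{- Let $k \ge 2$. Up to isomorphism, the only $k$-dicritical digraph with $k+1$ vertices is $\overset{\leftrightarrow}{K}_2(\overset{\leftrightarrow}{K}_{k-2}, \vec C_3)$, i.e. the digraph obtained from the disjoint union of a complete symmetric digraph on $k-2$ vertices and a directed $3$-cycle by adding all arcs in both directions between the two parts.
   Context: Digraphs are finite, without loops and parallel arcs (digons allowed). A dicolouring colours vertices so that each colour class induces an acyclic subdigraph; $G$ is $k$-dicritical if its dichromatic number is $k$ and every proper subdigraph has smaller dichromatic number. $\overset{\leftrightarrow}{K}_n$ is the complete symmetric digraph on $n$ vertices ($\overset{\leftrightarrow}{K}_0$ is empty) and $\vec C_3$ is the directed cycle on $3$ vertices. -}

module Defs where

open import Data.Nat using (ℕ; zero; suc; _<_; _+_)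
open import Data.Fin using (Fin; zero; suc; toℕ; fromℕ; splitAt; _≟_)
open import Data.Bool using (Bool; true; false; not; T)
open import Data.Sum using (_⊎_; inj₁; inj₂)
open import Data.Product using (Σ; ∃; _×_; _,_)
open import Relation.Nullary using (¬_; yes; no)
open import Relation.Nullary.Decidable using (⌊_⌋)
open import Relation.Binary.PropositionalEquality using (_≡_; refl)
open import Function.Definitions using (Injective)
open import Function.Bundles using (_↔_; Inverse)

-- Digraphs on the vertex set Fin n: an arc relation (decidable, Bool)
-- without loops. Digons (u→v and v→u) are allowed; parallel arcs are
-- impossible since arcs form a relation.

record Digraph (n : ℕ) : Set where
  field
    arc      : Fin n → Fin n → Bool
    loopless : ∀ v → arc v v ≡ false
open Digraph public

record Cycle {n : ℕ} (G : Digraph n) : Set where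
  field
    l      : ℕ
    vert   : Fin (suc (suc l)) → Fin n
    inj    : Injective _≡_ _≡_ vert
    step   : ∀ (i j : Fin (suc (suc l))) → toℕ j ≡ suc (toℕ i) →
             T (arc G (vert i) (vert j))
    close  : T (arc G (vert (fromℕ (suc l))) (vert zero))

IsDicolouring : ∀ {n} (G : Digraph n) {k : ℕ} → (Fin n → Fin k) → Set
IsDicolouring G c = ∀ (C : Cycle G) →
  ¬ (∀ i → c (Cycle.vert C i) ≡ c (Cycle.vert C zero))

Dicolourable : ∀ {n} → Digraph n → ℕ → Set
Dicolourable {n} G k = Σ (Fin n → Fin k) (IsDicolouring G)

HasDichromaticNumber : ∀ {n} → Digraph n → ℕ → Set
HasDichromaticNumber G k = Dicolourable G k × (∀ j → j < k → ¬ Dicolourable G j)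

record Subdigraph {n : ℕ} (G : Digraph n) : Set where
  field
    m      : ℕ
    H      : Digraph m
    emb    : Fin m → Fin n
    embInj : Injective _≡_ _≡_ emb
    arcsIn : ∀ u v → T (arc H u v) → T (arc G (emb u) (emb v))

Proper : ∀ {n} {G : Digraph n} → Subdigraph G → Set
Proper {n} {G} S = (Subdigraph.m S < n) ⊎
  (∃ λ u → ∃ λ v → T (arc G (Subdigraph.emb S u) (Subdigraph.emb S v))
                   × ¬ T (arc (Subdigraph.H S) u v))

Dicritical : ∀ {n} → Digraph n → ℕ → Set
Dicritical G k = HasDichromaticNumber G k ×
  (∀ (S : Subdigraph G) → Proper S →
     ∃ λ j → HasDichromaticNumber (Subdigraph.H S) j × j < k)

_≅_ : ∀ {n} → Digraph n → Digraph n → Set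
_≅_ {n} G H = Σ (Fin n ↔ Fin n) λ σ →
  ∀ u v → arc G u v ≡ arc H (Inverse.to σ u) (Inverse.to σ v)

-- K2(K_m, C3) on Fin (3 + m): vertices 0,1,2 form the directed 3-cycle
-- 0→1→2→0; the remaining m vertices form a complete symmetric digraph;
-- all arcs in both directions between the two parts.

c3 : Fin 3 → Fin 3 → Bool
c3 zero (suc zero) = true
c3 (suc zero) (suc (suc zero)) = true
c3 (suc (suc zero)) zero = true
c3 _ _ = false

c3-loopless : ∀ a → c3 a a ≡ false
c3-loopless zero = refl
c3-loopless (suc zero) = refl
c3-loopless (suc (suc zero)) = refl

K2KC3-arc : ∀ m → Fin (3 + m) → Fin (3 + m) → Bool
K2KC3-arc m u v with splitAt 3 u | splitAt 3 v
... | inj₁ a | inj₁ b = c3 a b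
... | _      | _      = not ⌊ u ≟ v ⌋

K2KC3-loopless : ∀ m v → K2KC3-arc m v v ≡ false
K2KC3-loopless m v with splitAt 3 v
... | inj₁ a = c3-loopless a
... | inj₂ b with v ≟ v
...   | yes _ = refl
...   | no ¬p = Relation.Nullary.contradiction refl ¬p
  where import Relation.Nullary

K2KC3 : ∀ m → Digraph (3 + m)
K2KC3 m = record { arc = K2KC3-arc m ; loopless = K2KC3-loopless m }

{-# OPTIONS --safe #-}

-- Write k = m + 2, so that the digraphs have m + 3 vertices and are compared with m + 1
-- colours. A set of vertices may share one colour whenever the arcs inside it follow a
-- ranking; so a non-digon pair saves one colour, and two disjoint non-digon pairs, or three
-- pairwise non-digon vertices spanning no directed triangle, save two. Hence in a
-- k-dicritical G the non-digon pairs pairwise intersect, and they cannot all pass through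
-- one vertex x, since G - x is (m + 1)-dicolourable and so not complete symmetric. They
-- therefore form a triangle {a, b, c}, which must be a directed 3-cycle, while every other
-- pair is a digon; any two digraphs with such a triangle core are isomorphic.
-- Conversely K2(K_m, C3) needs m + 2 colours: some arc of its 3-cycle is bichromatic, and
-- the remaining m + 2 vertices then have pairwise distinct colours. Deleting an arc of the
-- 3-cycle makes the three vertices orderable, deleting any other arc creates a non-digon
-- pair disjoint from a pair of the 3-cycle, and deleting a vertex removes its out-arcs.

module Submission where

open import Defs
open import Data.Nat as ℕ using (ℕ; zero; suc; _<_; _≤_; _+_)
import Data.Nat.Properties as ℕ
open import Data.Fin as Fin using (Fin; zero; suc; toℕ; fromℕ; inject₁; inject≤; punchIn; punchOut; _≟_; _↑ˡ_)
import Data.Fin.Properties as Fin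
open import Data.Fin.Patterns using (0F; 1F; 2F)
open import Data.Fin.Permutation as Perm using (Permutation′; _⟨$⟩ʳ_; _∘ₚ_; transpose)
import Data.Fin.Permutation.Components as PC
open import Data.Vec.Functional using (_∷_; [])
open import Data.Bool using (true; false; T; _∧_; not)
open import Data.Bool.Properties using (T?; T-∧; T-≡)
open import Data.Sum as Sum using (_⊎_; inj₁; inj₂)
open import Data.Product using (∃; _×_; _,_; proj₁; proj₂; swap)
open import Data.Empty using (⊥; ⊥-elim)
open import Function using (id; _∘_)
open import Function.Definitions using (Injective)
open import Function.Bundles using (Equivalence; Inverse; Injection; _⇔_; mk⇔)
open import Function.Construct.Symmetry using (↔-sym)
open import Function.Properties.Inverse using (↔⇒↣)
open import Relation.Nullary using (¬_; Dec; yes; no; contradiction)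
open import Relation.Nullary.Decidable using (_×-dec_; _→-dec_; ¬?; map′; ⌊_⌋; fromWitnessFalse; toWitnessFalse)
open import Relation.Binary.PropositionalEquality

private
  variable
    n k : ℕ

pattern 2+ i = suc (suc i)
pattern 3+ i = suc (suc (suc i))

T⇒≡true : ∀ {b} → T b → b ≡ true
T⇒≡true = Equivalence.to T-≡

¬T⇒≡false : ∀ {b} → ¬ T b → b ≡ false
¬T⇒≡false {false} _  = refl
¬T⇒≡false {true}  ¬t = contradiction _ ¬t

Digon : Digraph n → Fin n → Fin n → Set
Digon G x y = T (arc G x y) × T (arc G y x)

NonDigon : Digraph n → Fin n → Fin n → Set
NonDigon G x y = x ≢ y × ¬ Digon G x y

¬Digon⇒¬reverse : (G : Digraph n) {x y : Fin n} → ¬ Digon G x y → T (arc G y x) → ¬ T (arc G x y)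
¬Digon⇒¬reverse G ¬xy↔ yx xy = ¬xy↔ (xy , yx)

NonDigon-sym : (G : Digraph n) {x y : Fin n} → NonDigon G x y → NonDigon G y x
NonDigon-sym G (x≢y , ¬xy↔) = ≢-sym x≢y , ¬xy↔ ∘ swap

Triangle : Digraph n → Fin n → Fin n → Fin n → Set
Triangle G x y z = T (arc G x y) × T (arc G y z) × T (arc G z x)

¬arc-loop : (G : Digraph n) (v : Fin n) → ¬ T (arc G v v)
¬arc-loop G v t rewrite loopless G v = t

arc⇒≢ : (G : Digraph n) {u v : Fin n} → T (arc G u v) → u ≢ v
arc⇒≢ G {u} t refl = ¬arc-loop G u t

module _ (G : Digraph n) where

  digon-cycle : {x y : Fin n} → x ≢ y → Digon G x y → Cycle G
  digon-cycle {x} {y} x≢y (xy , yx) = record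
    { l = 0 ; vert = vert ; inj = inj ; step = step ; close = yx }
    where
    vert : Fin 2 → Fin n
    vert = x ∷ y ∷ []
    inj : ∀ {i j} → vert i ≡ vert j → i ≡ j
    inj {0F} {0F} _ = refl
    inj {0F} {1F} e = contradiction e x≢y
    inj {1F} {0F} e = contradiction (sym e) x≢y
    inj {1F} {1F} _ = refl
    step : ∀ i j → toℕ j ≡ suc (toℕ i) → T (arc G (vert i) (vert j))
    step 0F 1F _  = xy
    step 0F 0F ()
    step 1F 0F ()
    step 1F 1F ()

  triangle-cycle : {x y z : Fin n} → x ≢ y → y ≢ z → x ≢ z → Triangle G x y z → Cycle G
  triangle-cycle {x} {y} {z} x≢y y≢z x≢z (xy , yz , zx) = record
    { l = 1 ; vert = vert ; inj = inj ; step = step ; close = zx }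
    where
    vert : Fin 3 → Fin n
    vert = x ∷ y ∷ z ∷ []
    inj : ∀ {i j} → vert i ≡ vert j → i ≡ j
    inj {0F} {0F} _ = refl
    inj {0F} {1F} e = contradiction e x≢y
    inj {0F} {2F} e = contradiction e x≢z
    inj {1F} {0F} e = contradiction (sym e) x≢y
    inj {1F} {1F} _ = refl
    inj {1F} {2F} e = contradiction e y≢z
    inj {2F} {0F} e = contradiction (sym e) x≢z
    inj {2F} {1F} e = contradiction (sym e) y≢z
    inj {2F} {2F} _ = refl
    step : ∀ i j → toℕ j ≡ suc (toℕ i) → T (arc G (vert i) (vert j))
    step 0F 1F _  = xy
    step 1F 2F _  = yz
    step 0F 0F ()
    step 0F 2F ()
    step 1F 0F ()
    step 1F 1F ()
    step 2F 0F ()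
    step 2F 1F ()
    step 2F 2F ()

module _ {G : Digraph n} {c : Fin n → Fin k} (dicolouring : IsDicolouring G c) where

  digon-separates : {x y : Fin n} → x ≢ y → Digon G x y → c x ≢ c y
  digon-separates {x} x≢y d cx≡cy = dicolouring (digon-cycle G x≢y d) monochromatic
    where
    monochromatic : ∀ i → c (Cycle.vert (digon-cycle G x≢y d) i) ≡ c x
    monochromatic 0F = refl
    monochromatic 1F = sym cx≡cy

  triangle-separates : {x y z : Fin n} → x ≢ y → y ≢ z → x ≢ z → Triangle G x y z →
                       c x ≡ c y → c y ≢ c z
  triangle-separates x≢y y≢z x≢z t cx≡cy cy≡cz = dicolouring (triangle-cycle G x≢y y≢z x≢z t) λ
    { 0F → refl ; 1F → sym cx≡cy ; 2F → sym (trans cx≡cy cy≡cz) }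

-- Colourings certified by rankings

record Ranking (G : Digraph n) (c : Fin n → Fin k) : Set where
  field
    rank       : Fin n → ℕ
    bound      : ℕ
    rank<bound : ∀ v → rank v < bound
    ascending  : ∀ {u v} → T (arc G u v) → c u ≡ c v → rank u < rank v

ascending-from-zero : ∀ {m} (f : Fin (suc m) → ℕ) →
  (∀ i → f (inject₁ i) ≤ f (suc i)) → ∀ i → f zero ≤ f i
ascending-from-zero f step zero = ℕ.≤-refl
ascending-from-zero {suc m} f step (suc i) =
  ℕ.≤-trans (ascending-from-zero (f ∘ inject₁) (step ∘ inject₁) i) (step i)

ranking⇒dicolouring : {G : Digraph n} {c : Fin n → Fin k} → Ranking G c → IsDicolouring G c
ranking⇒dicolouring {G = G} {c} R C monochromatic =
  ℕ.<-irrefl refl (ℕ.≤-<-trans (ascending-from-zero (rank ∘ vert) forward (fromℕ (suc l))) back)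
  where
  open Ranking R
  open Cycle C
  same-colour : ∀ i j → c (vert i) ≡ c (vert j)
  same-colour i j = trans (monochromatic i) (sym (monochromatic j))
  forward : ∀ i → rank (vert (inject₁ i)) ≤ rank (vert (suc i))
  forward i = ℕ.<⇒≤ (ascending (step (inject₁ i) (suc i) (cong suc (sym (Fin.toℕ-inject₁ i))))
                               (same-colour _ _))
  back : rank (vert (fromℕ (suc l))) < rank (vert zero)
  back = ascending close (same-colour _ _)

module _ {α β : Fin (suc k)} (α≢β : α ≢ β) where

  private
    replace : Fin (suc k) → Fin (suc k)
    replace γ with γ ≟ α
    ... | yes _ = β
    ... | no  _ = γ

    replace-avoids : ∀ γ → α ≢ replace γ
    replace-avoids γ with γ ≟ α
    ... | yes _   = α≢β
    ... | no γ≢α = γ≢α ∘ sym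

    replace-fibres : ∀ {γ δ} → replace γ ≡ replace δ →
                     γ ≡ δ ⊎ (γ ≡ α × δ ≡ β) ⊎ (γ ≡ β × δ ≡ α)
    replace-fibres {γ} {δ} eq with γ ≟ α | δ ≟ α
    ... | yes γ≡α | yes δ≡α = inj₁ (trans γ≡α (sym δ≡α))
    ... | yes γ≡α | no  _   = inj₂ (inj₁ (γ≡α , sym eq))
    ... | no  _   | yes δ≡α = inj₂ (inj₂ (eq , δ≡α))
    ... | no  _   | no  _   = inj₁ eq

  identify : Fin (suc k) → Fin k
  identify γ = punchOut (replace-avoids γ)

  identify-fibres : ∀ {γ δ} → identify γ ≡ identify δ →
                    γ ≡ δ ⊎ (γ ≡ α × δ ≡ β) ⊎ (γ ≡ β × δ ≡ α)
  identify-fibres {γ} {δ} = replace-fibres ∘ Fin.punchOut-injective (replace-avoids γ) (replace-avoids δ)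

  identify-injective-off : ∀ {γ δ} → δ ≢ α → δ ≢ β → identify γ ≡ identify δ → γ ≡ δ
  identify-injective-off δ≢α δ≢β eq with identify-fibres eq
  ... | inj₁ γ≡δ              = γ≡δ
  ... | inj₂ (inj₁ (_ , δ≡β)) = contradiction δ≡β δ≢β
  ... | inj₂ (inj₂ (_ , δ≡α)) = contradiction δ≡α δ≢α

NoArcs : Digraph n → (Fin n → Fin k) → Fin k → Fin k → Set
NoArcs G c β α = ∀ {u v} → c u ≡ β → c v ≡ α → ¬ T (arc G u v)

module _ {G : Digraph n} {c : Fin n → Fin (suc k)} (R : Ranking G c) where

  open Ranking R

  -- Arcs between the two merged classes only go upwards, so lifting the upper class above
  -- every existing rank keeps ranks increasing along monochromatic arcs.
  coarsen-ranking : (κ : Fin (suc k) → Fin k) (lower upper : Fin (suc k)) →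
    (∀ {γ δ} → κ γ ≡ κ δ → γ ≡ δ ⊎ (γ ≡ lower × δ ≡ upper) ⊎ (γ ≡ upper × δ ≡ lower)) →
    NoArcs G c upper lower → Ranking G (κ ∘ c)
  coarsen-ranking κ lower upper fibres no-arcs = record
    { rank = rank′ ; bound = bound + bound ; rank<bound = rank′<bound ; ascending = ascending′ }
    where
    rank′ : Fin n → ℕ
    rank′ v with c v ≟ upper
    ... | yes _ = bound + rank v
    ... | no  _ = rank v

    rank′<bound : ∀ v → rank′ v < bound + bound
    rank′<bound v with c v ≟ upper
    ... | yes _ = ℕ.+-monoʳ-< bound (rank<bound v)
    ... | no  _ = ℕ.<-≤-trans (rank<bound v) (ℕ.m≤m+n bound bound)

    ascending′ : ∀ {u v} → T (arc G u v) → κ (c u) ≡ κ (c v) → rank′ u < rank′ v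
    ascending′ {u} {v} uv same with c u ≟ upper | c v ≟ upper | fibres same
    ... | yes u↑  | yes v↑  | _                     = ℕ.+-monoʳ-< bound (ascending uv (trans u↑ (sym v↑)))
    ... | no  _   | yes _   | _                     = ℕ.<-≤-trans (rank<bound u) (ℕ.m≤m+n bound _)
    ... | no  _   | no  _   | inj₁ cu≡cv            = ascending uv cu≡cv
    ... | no  _   | no ¬v↑  | inj₂ (inj₁ (_ , v↑))  = contradiction v↑ ¬v↑
    ... | no ¬u↑  | no  _   | inj₂ (inj₂ (u↑ , _))  = contradiction u↑ ¬u↑
    ... | yes u↑  | no ¬v↑  | inj₁ cu≡cv            = contradiction (trans (sym cu≡cv) u↑) ¬v↑
    ... | yes _   | no ¬v↑  | inj₂ (inj₁ (_ , v↑))  = contradiction v↑ ¬v↑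
    ... | yes _   | no  _   | inj₂ (inj₂ (u↑ , v↓)) = contradiction uv (no-arcs u↑ v↓)

  identify-ranking : {α β : Fin (suc k)} (α≢β : α ≢ β) →
    NoArcs G c β α ⊎ NoArcs G c α β → Ranking G (identify α≢β ∘ c)
  identify-ranking {α} {β} α≢β (inj₁ no-arcs) =
    coarsen-ranking (identify α≢β) α β (identify-fibres α≢β) no-arcs
  identify-ranking {α} {β} α≢β (inj₂ no-arcs) =
    coarsen-ranking (identify α≢β) β α (Sum.map₂ Sum.swap ∘ identify-fibres α≢β) no-arcs

discrete-ranking : (G : Digraph n) → Ranking G id
discrete-ranking G = record
  { rank = λ _ → 0 ; bound = 1 ; rank<bound = λ _ → ℕ.s≤s ℕ.z≤n
  ; ascending = λ {u} uv u≡v → contradiction u≡v (arc⇒≢ G uv) }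

module _ (G : Digraph n) {c : Fin n → Fin k} where

  singleton-classes-one-way : {x y : Fin n} →
    (∀ {u} → c u ≡ c x → u ≡ x) → (∀ {u} → c u ≡ c y → u ≡ y) → ¬ Digon G x y →
    NoArcs G c (c y) (c x) ⊎ NoArcs G c (c x) (c y)
  singleton-classes-one-way {x} {y} only-x only-y ¬xy↔ with T? (arc G y x)
  ... | no ¬yx = inj₁ λ u∼y v∼x uv → ¬yx (subst₂ (λ a b → T (arc G a b)) (only-y u∼y) (only-x v∼x) uv)
  ... | yes yx = inj₂ λ u∼x v∼y uv →
    ¬Digon⇒¬reverse G ¬xy↔ yx (subst₂ (λ a b → T (arc G a b)) (only-x u∼x) (only-y v∼y) uv)

non-digon-pair⇒dicolourable : (G : Digraph (suc k)) {x y : Fin (suc k)} →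
  NonDigon G x y → Dicolourable G k
non-digon-pair⇒dicolourable G (x≢y , ¬xy↔) =
  identify x≢y ,
  ranking⇒dicolouring (identify-ranking (discrete-ranking G) x≢y (singleton-classes-one-way G id id ¬xy↔))

disjoint-non-digon-pairs⇒dicolourable : (G : Digraph (suc (suc k))) {a b c d : Fin (suc (suc k))} →
  NonDigon G a b → NonDigon G c d → a ≢ c → a ≢ d → b ≢ c → b ≢ d → Dicolourable G k
disjoint-non-digon-pairs⇒dicolourable G {a} {b} {c} {d} (a≢b , ¬ab↔) (c≢d , ¬cd↔) a≢c a≢d b≢c b≢d =
  identify c₁c≢c₁d ∘ c₁ , ranking⇒dicolouring (identify-ranking R₁ c₁c≢c₁d one-way)
  where
  c₁ = identify a≢b
  R₁ = identify-ranking (discrete-ranking G) a≢b (singleton-classes-one-way G id id ¬ab↔)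
  only-c : ∀ {u} → c₁ u ≡ c₁ c → u ≡ c
  only-c = identify-injective-off a≢b (≢-sym a≢c) (≢-sym b≢c)
  only-d : ∀ {u} → c₁ u ≡ c₁ d → u ≡ d
  only-d = identify-injective-off a≢b (≢-sym a≢d) (≢-sym b≢d)
  c₁c≢c₁d : c₁ c ≢ c₁ d
  c₁c≢c₁d = c≢d ∘ only-d
  one-way = singleton-classes-one-way G only-c only-d ¬cd↔

record ForwardTriple (G : Digraph n) : Set where
  constructor forward-triple
  field
    p q s : Fin n
    p≢q   : p ≢ q
    q≢s   : q ≢ s
    p≢s   : p ≢ s
    ¬qp   : ¬ T (arc G q p)
    ¬sq   : ¬ T (arc G s q)
    ¬sp   : ¬ T (arc G s p)

forward-triple⇒dicolourable : (G : Digraph (suc (suc k))) → ForwardTriple G → Dicolourable G k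
forward-triple⇒dicolourable G t =
  identify c₁p≢c₁s ∘ c₁ , ranking⇒dicolouring (identify-ranking R₁ c₁p≢c₁s (inj₁ no-arcs))
  where
  open ForwardTriple t
  c₁ = identify p≢q
  R₁ = identify-ranking (discrete-ranking G) p≢q (inj₁ λ { refl refl → ¬qp })
  c₁p≢c₁s : c₁ p ≢ c₁ s
  c₁p≢c₁s = p≢s ∘ identify-injective-off p≢q (≢-sym p≢s) (≢-sym q≢s)
  no-arcs : NoArcs G c₁ (c₁ s) (c₁ p)
  no-arcs {u} {v} u∼s v∼p
    with refl ← identify-injective-off p≢q {u} (≢-sym p≢s) (≢-sym q≢s) u∼s
    with identify-fibres p≢q {v} {p} v∼p
  ... | inj₁ refl              = ¬sp
  ... | inj₂ (inj₁ (refl , _)) = ¬sp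
  ... | inj₂ (inj₂ (refl , _)) = ¬sq

triangle-or-forward : (G : Digraph n) {x y z : Fin n} →
  NonDigon G x y → NonDigon G y z → NonDigon G x z →
  Triangle G x y z ⊎ Triangle G x z y ⊎ ForwardTriple G
triangle-or-forward G {x} {y} {z} (x≢y , ¬xy↔) (y≢z , ¬yz↔) (x≢z , ¬xz↔)
  with T? (arc G y x) | T? (arc G z x) | T? (arc G z y) | T? (arc G x z) | T? (arc G y z) | T? (arc G x y)
... | yes yx | _      | yes zy | yes xz | _      | _      = inj₂ (inj₁ (xz , zy , yx))
... | yes yx | _      | yes zy | no ¬xz | _      | _      = inj₂ (inj₂ (forward-triple z y x
  (≢-sym y≢z) (≢-sym x≢y) (≢-sym x≢z) (¬Digon⇒¬reverse G ¬yz↔ zy) (¬Digon⇒¬reverse G ¬xy↔ yx) ¬xz))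
... | yes yx | yes zx | no ¬zy | _      | _      | _      = inj₂ (inj₂ (forward-triple y z x
  y≢z (≢-sym x≢z) (≢-sym x≢y) ¬zy (¬Digon⇒¬reverse G ¬xz↔ zx) (¬Digon⇒¬reverse G ¬xy↔ yx)))
... | yes yx | no ¬zx | no ¬zy | _      | _      | _      = inj₂ (inj₂ (forward-triple y x z
  (≢-sym x≢y) x≢z y≢z (¬Digon⇒¬reverse G ¬xy↔ yx) ¬zx ¬zy))
... | no ¬yx | no ¬zx | yes zy | _      | _      | _      = inj₂ (inj₂ (forward-triple x z y
  x≢z (≢-sym y≢z) x≢y ¬zx (¬Digon⇒¬reverse G ¬yz↔ zy) ¬yx))
... | no ¬yx | no ¬zx | no ¬zy | _      | _      | _      = inj₂ (inj₂ (forward-triple x y z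
  x≢y y≢z x≢z ¬yx ¬zy ¬zx))
... | no ¬yx | yes zx | _      | _      | no ¬yz | _      = inj₂ (inj₂ (forward-triple z x y
  (≢-sym x≢z) x≢y (≢-sym y≢z) (¬Digon⇒¬reverse G ¬xz↔ zx) ¬yx ¬yz))
... | no ¬yx | yes zx | _      | _      | yes yz | yes xy = inj₁ (xy , yz , zx)
... | no ¬yx | yes zx | _      | _      | yes yz | no ¬xy = inj₂ (inj₂ (forward-triple y z x
  y≢z (≢-sym x≢z) (≢-sym x≢y) (¬Digon⇒¬reverse G (¬yz↔ ∘ swap) yz) (¬Digon⇒¬reverse G ¬xz↔ zx) ¬xy))

-- Deciding dicolourability

any-function? : ∀ n {k} (P : (Fin n → Fin k) → Set) →
  (∀ {f g} → (∀ i → f i ≡ g i) → P f → P g) → (∀ f → Dec (P f)) → Dec (∃ P)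
any-function? zero P resp P? = map′ (λ p → _ , p) (λ (f , p) → resp (λ ()) p) (P? λ ())
any-function? (suc n) P resp P?
  with Fin.any? (λ a → any-function? n (P ∘ (a ∷_)) (λ f≗g → resp λ { zero → refl ; (suc i) → f≗g i })
                                     (P? ∘ (a ∷_)))
... | yes (a , f , p) = yes (a ∷ f , p)
... | no ¬p = no λ (f , p) → ¬p (f zero , f ∘ suc , resp (λ { zero → refl ; (suc i) → refl }) p)

module _ (G : Digraph n) {k} (c : Fin n → Fin k) where

  private
    MonochromaticCycle : ∀ l → (Fin (suc (suc l)) → Fin n) → Set
    MonochromaticCycle l vert =
      (∀ i j → vert i ≡ vert j → i ≡ j) ×
      (∀ i j → toℕ j ≡ suc (toℕ i) → T (arc G (vert i) (vert j))) ×
      T (arc G (vert (fromℕ (suc l))) (vert zero)) ×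
      (∀ i → c (vert i) ≡ c (vert zero))

    respects : ∀ l {f g} → (∀ i → f i ≡ g i) → MonochromaticCycle l f → MonochromaticCycle l g
    respects l f≗g (inj , step , close , mono) =
      (λ i j gi≡gj → inj i j (trans (f≗g i) (trans gi≡gj (sym (f≗g j))))) ,
      (λ i j j≡1+i → subst₂ (λ u v → T (arc G u v)) (f≗g i) (f≗g j) (step i j j≡1+i)) ,
      subst₂ (λ u v → T (arc G u v)) (f≗g _) (f≗g zero) close ,
      (λ i → trans (cong c (sym (f≗g i))) (trans (mono i) (cong c (f≗g zero))))

    decide : ∀ l vert → Dec (MonochromaticCycle l vert)
    decide l vert =
      Fin.all? (λ i → Fin.all? λ j → vert i ≟ vert j →-dec i ≟ j) ×-dec
      Fin.all? (λ i → Fin.all? λ j → toℕ j ℕ.≟ suc (toℕ i) →-dec T? _) ×-dec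
      T? _ ×-dec
      Fin.all? (λ i → c (vert i) ≟ c (vert zero))

  is-dicolouring? : Dec (IsDicolouring G c)
  is-dicolouring?
    with ℕ.anyUpTo? (λ l → any-function? (suc (suc l)) (MonochromaticCycle l) (respects l) (decide l)) n
  ... | yes (l , _ , vert , inj , step , close , mono) =
    no λ dicolouring →
      dicolouring (record { l = l ; vert = vert ; inj = inj _ _ ; step = step ; close = close }) mono
  ... | no ¬cycle = yes λ C mono →
    ¬cycle (Cycle.l C , ℕ.<⇒≤ (Fin.injective⇒≤ (Cycle.inj C)) ,
            Cycle.vert C , (λ _ _ → Cycle.inj C) , Cycle.step C , Cycle.close C , mono)

IsDicolouring-resp : (G : Digraph n) {f g : Fin n → Fin k} →
  (∀ v → f v ≡ g v) → IsDicolouring G f → IsDicolouring G g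
IsDicolouring-resp G f≗g dicolouring C mono =
  dicolouring C λ i → trans (f≗g _) (trans (mono i) (sym (f≗g _)))

dicolourable? : (G : Digraph n) (k : ℕ) → Dec (Dicolourable G k)
dicolourable? {n} G k = any-function? n (IsDicolouring G) (IsDicolouring-resp G) (is-dicolouring? G)

Dicolourable-mono : (G : Digraph n) {j k : ℕ} → j ≤ k → Dicolourable G j → Dicolourable G k
Dicolourable-mono G j≤k (c , dicolouring) =
  (λ v → inject≤ (c v) j≤k) ,
  λ C mono → dicolouring C (λ i → Fin.inject≤-injective j≤k j≤k _ _ (mono i))

-- Dicritical asks for the exact dichromatic number of every proper subdigraph, which
-- constructively needs dicolourability to be decidable.
dichromatic-number-≤ : (G : Digraph n) {k : ℕ} → Dicolourable G k →
  ∃ λ j → HasDichromaticNumber G j × j ≤ k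
dichromatic-number-≤ G {zero} col = zero , (col , λ _ ()) , ℕ.z≤n
dichromatic-number-≤ G {suc k} col with dicolourable? G k
... | yes col-k = let (j , χ , j≤k) = dichromatic-number-≤ G col-k in j , χ , ℕ.m≤n⇒m≤1+n j≤k
... | no ¬col-k =
  suc k , (col , λ j j<1+k col-j → ¬col-k (Dicolourable-mono G (ℕ.≤-pred j<1+k) col-j)) , ℕ.≤-refl

Dicolourable-pullback : {m : ℕ} (G : Digraph n) (H : Digraph m) (f : Fin n → Fin m) →
  Injective _≡_ _≡_ f → (∀ u v → T (arc G u v) → T (arc H (f u) (f v))) →
  Dicolourable H k → Dicolourable G k
Dicolourable-pullback G H f f-inj hom (c , dicolouring) = c ∘ f , λ C mono →
  dicolouring (record
    { l = Cycle.l C ; vert = f ∘ Cycle.vert C ; inj = Cycle.inj C ∘ f-inj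
    ; step = λ i j j≡1+i → hom _ _ (Cycle.step C i j j≡1+i) ; close = hom _ _ (Cycle.close C) })
    mono

dicolourable⇒non-digon-pair : (G : Digraph (suc k)) → Dicolourable G k → ∃ λ x → ∃ λ y → NonDigon G x y
dicolourable⇒non-digon-pair G (c , dicolouring) with i , j , i<j , ci≡cj ← Fin.pigeonhole ℕ.≤-refl c =
  i , j , Fin.<⇒≢ i<j , λ ij↔ → digon-separates dicolouring (Fin.<⇒≢ i<j) ij↔ ci≡cj

deleteArc : Digraph n → Fin n → Fin n → Digraph n
deleteArc G u v = record
  { arc      = λ x y → arc G x y ∧ not ⌊ (x ≟ u) ×-dec (y ≟ v) ⌋
  ; loopless = λ x → cong (_∧ _) (loopless G x) }

module _ (G : Digraph n) {u v : Fin n} where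

  deleteArc-⊆ : ∀ {x y} → T (arc (deleteArc G u v) x y) → T (arc G x y)
  deleteArc-⊆ = proj₁ ∘ Equivalence.to T-∧

  deleteArc-keeps : ∀ {x y} → T (arc G x y) → ¬ (x ≡ u × y ≡ v) → T (arc (deleteArc G u v) x y)
  deleteArc-keeps xy ≢uv = Equivalence.from T-∧ (xy , fromWitnessFalse ≢uv)

  deleteArc-deletes : ¬ T (arc (deleteArc G u v) u v)
  deleteArc-deletes uv =
    toWitnessFalse {a? = (u ≟ u) ×-dec (v ≟ v)} (proj₂ (Equivalence.to (T-∧ {arc G u v}) uv)) (refl , refl)

  ¬Digon-deleteArc : ∀ {x y} → ¬ Digon G x y → ¬ Digon (deleteArc G u v) x y
  ¬Digon-deleteArc ¬xy↔ (xy , yx) = ¬xy↔ (deleteArc-⊆ xy , deleteArc-⊆ yx)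

deleteVertex : (G : Digraph (suc n)) → Fin (suc n) → Subdigraph G
deleteVertex G x = record
  { H = record { arc = λ u v → arc G (punchIn x u) (punchIn x v) ; loopless = loopless G ∘ punchIn x }
  ; emb = punchIn x ; embInj = Fin.punchIn-injective x _ _ ; arcsIn = λ _ _ uv → uv }

<⇒misses-point : {m : ℕ} → m < n → (f : Fin m → Fin n) → ∃ λ w → ∀ u → f u ≢ w
<⇒misses-point {n} {m} m<n f with Fin.any? (λ w → Fin.all? λ u → ¬? (f u ≟ w))
... | yes missed = missed
... | no ¬missed = ⊥-elim (ℕ.<⇒≱ m<n (Fin.injective⇒≤ {f = preimage} preimage-injective))
  where
  hit : ∀ w → ∃ λ u → f u ≡ w
  hit w with Fin.any? (λ u → f u ≟ w)
  ... | yes h = h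
  ... | no ¬h = contradiction (w , λ u fu≡w → ¬h (u , fu≡w)) ¬missed
  preimage : Fin n → Fin m
  preimage = proj₁ ∘ hit
  preimage-injective : Injective _≡_ _≡_ preimage
  preimage-injective {w} {w′} eq = trans (sym (proj₂ (hit w))) (trans (cong f eq) (proj₂ (hit w′)))

module _ (G : Digraph n) (S : Subdigraph G) where

  open Subdigraph S

  -- A missing vertex w is dealt with by deleting any arc leaving w.
  proper⇒avoids-arc : (∀ w → ∃ λ v → T (arc G w v)) → Proper S →
    ∃ λ u → ∃ λ v → T (arc G u v) × (∀ x y → T (arc H x y) → ¬ (emb x ≡ u × emb y ≡ v))
  proper⇒avoids-arc out (inj₁ m<n) with w , ∉emb ← <⇒misses-point m<n emb =
    w , proj₁ (out w) , proj₂ (out w) , λ x _ _ (emb-x≡w , _) → ∉emb x emb-x≡w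
  proper⇒avoids-arc _ (inj₂ (x , y , xy , ¬xy)) =
    emb x , emb y , xy , λ { x′ y′ x′y′ (ex′≡ex , ey′≡ey) →
      ¬xy (subst₂ (λ a b → T (arc H a b)) (embInj ex′≡ex) (embInj ey′≡ey) x′y′) }

  embeds-into-deleteArc : ∀ {u v} → (∀ x y → T (arc H x y) → ¬ (emb x ≡ u × emb y ≡ v)) →
    ∀ x y → T (arc H x y) → T (arc (deleteArc G u v) (emb x) (emb y))
  embeds-into-deleteArc avoids x y xy = deleteArc-keeps G (arcsIn x y xy) (avoids x y xy)

-- Digraphs with a triangle core are isomorphic

transpose-source : (i j : Fin n) → PC.transpose i j i ≡ j
transpose-source i j with i ≟ i
... | yes _   = refl
... | no  i≢i = contradiction refl i≢i

transpose-elsewhere : {i j k : Fin n} → k ≢ i → k ≢ j → PC.transpose i j k ≡ k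
transpose-elsewhere {i = i} {j} {k} k≢i k≢j with k ≟ i
... | yes k≡i = contradiction k≡i k≢i
... | no  _ with k ≟ j
...   | yes k≡j = contradiction k≡j k≢j
...   | no  _   = refl

module _ (π : Permutation′ n) (x t : Fin n) where

  send : Permutation′ n
  send = π ∘ₚ transpose (π ⟨$⟩ʳ x) t

  send-sends : send ⟨$⟩ʳ x ≡ t
  send-sends = transpose-source (π ⟨$⟩ʳ x) t

  send-fixes : ∀ {y} → y ≢ x → π ⟨$⟩ʳ y ≢ t → send ⟨$⟩ʳ y ≡ π ⟨$⟩ʳ y
  send-fixes y≢x = transpose-elsewhere (y≢x ∘ Injection.injective (↔⇒↣ π))

  send-keeps : ∀ {y s} → y ≢ x → s ≢ t → π ⟨$⟩ʳ y ≡ s → send ⟨$⟩ʳ y ≡ s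
  send-keeps y≢x s≢t πy≡s = trans (send-fixes y≢x (s≢t ∘ trans (sym πy≡s))) πy≡s

record TriangleCore (G : Digraph n) : Set where
  field
    corner         : Fin 3 → Fin n
    corner-arcs    : ∀ i j → arc G (corner i) (corner j) ≡ c3 i j
    digon-off-core : ∀ {u v} → u ≢ v → (∀ i → u ≢ corner i) → Digon G u v

  corner-arc : ∀ i j → T (c3 i j) → T (arc G (corner i) (corner j))
  corner-arc i j = subst T (sym (corner-arcs i j))

  corner-injective : ∀ {i j} → corner i ≡ corner j → i ≡ j
  corner-injective {0F} {0F} _ = refl
  corner-injective {1F} {1F} _ = refl
  corner-injective {2F} {2F} _ = refl
  corner-injective {0F} {1F} e = contradiction e       (arc⇒≢ G (corner-arc 0F 1F _))
  corner-injective {1F} {0F} e = contradiction (sym e) (arc⇒≢ G (corner-arc 0F 1F _))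
  corner-injective {1F} {2F} e = contradiction e       (arc⇒≢ G (corner-arc 1F 2F _))
  corner-injective {2F} {1F} e = contradiction (sym e) (arc⇒≢ G (corner-arc 1F 2F _))
  corner-injective {2F} {0F} e = contradiction e       (arc⇒≢ G (corner-arc 2F 0F _))
  corner-injective {0F} {2F} e = contradiction (sym e) (arc⇒≢ G (corner-arc 2F 0F _))

module _ {G H : Digraph n} (coreG : TriangleCore G) (coreH : TriangleCore H) where

  private
    module CG = TriangleCore coreG
    module CH = TriangleCore coreH
    a = CG.corner
    b = CH.corner

    a-distinct : ∀ {i j} → i ≢ j → a i ≢ a j
    a-distinct i≢j = i≢j ∘ CG.corner-injective

    b-distinct : ∀ {i j} → i ≢ j → b i ≢ b j
    b-distinct i≢j = i≢j ∘ CH.corner-injective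

    σ₁ σ₂ σ : Permutation′ n
    σ₁ = send Perm.id (a 0F) (b 0F)
    σ₂ = send σ₁ (a 1F) (b 1F)
    σ  = send σ₂ (a 2F) (b 2F)

  σ-corner : ∀ i → σ ⟨$⟩ʳ a i ≡ b i
  σ-corner 0F = send-keeps σ₂ (a 2F) (b 2F) (a-distinct λ ()) (b-distinct λ ())
                  (send-keeps σ₁ (a 1F) (b 1F) (a-distinct λ ()) (b-distinct λ ())
                     (send-sends Perm.id (a 0F) (b 0F)))
  σ-corner 1F = send-keeps σ₂ (a 2F) (b 2F) (a-distinct λ ()) (b-distinct λ ()) (send-sends σ₁ (a 1F) (b 1F))
  σ-corner 2F = send-sends σ₂ (a 2F) (b 2F)

  private
    σ-off-core : ∀ {u} → (∀ i → u ≢ a i) → ∀ i → σ ⟨$⟩ʳ u ≢ b i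
    σ-off-core u∉ i σu≡bi = u∉ i (Injection.injective (↔⇒↣ σ) (trans σu≡bi (sym (σ-corner i))))

    agree-off-core : ∀ {u v} → (∀ i → u ≢ a i) ⊎ (∀ i → v ≢ a i) →
                     arc G u v ≡ arc H (σ ⟨$⟩ʳ u) (σ ⟨$⟩ʳ v)
    agree-off-core {u} {v} off with u ≟ v
    ... | yes refl = trans (loopless G u) (sym (loopless H (σ ⟨$⟩ʳ u)))
    ... | no u≢v   = trans (T⇒≡true (proj₁ (digon-G off))) (sym (T⇒≡true (proj₁ (digon-H off))))
      where
      σu≢σv : σ ⟨$⟩ʳ u ≢ σ ⟨$⟩ʳ v
      σu≢σv = u≢v ∘ Injection.injective (↔⇒↣ σ)
      digon-G : (∀ i → u ≢ a i) ⊎ (∀ i → v ≢ a i) → Digon G u v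
      digon-G (inj₁ u∉) = CG.digon-off-core u≢v u∉
      digon-G (inj₂ v∉) = swap (CG.digon-off-core (≢-sym u≢v) v∉)
      digon-H : (∀ i → u ≢ a i) ⊎ (∀ i → v ≢ a i) → Digon H (σ ⟨$⟩ʳ u) (σ ⟨$⟩ʳ v)
      digon-H (inj₁ u∉) = CH.digon-off-core σu≢σv (σ-off-core u∉)
      digon-H (inj₂ v∉) = swap (CH.digon-off-core (≢-sym σu≢σv) (σ-off-core v∉))

    on-core? : ∀ u → Dec (∃ λ i → u ≡ a i)
    on-core? u = Fin.any? (λ i → u ≟ a i)

    off-core : ∀ {u} → ¬ (∃ λ i → u ≡ a i) → ∀ i → u ≢ a i
    off-core ¬on i u≡ai = ¬on (i , u≡ai)

  arcs-agree : ∀ u v → arc G u v ≡ arc H (σ ⟨$⟩ʳ u) (σ ⟨$⟩ʳ v)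
  arcs-agree u v with on-core? u | on-core? v
  ... | yes (i , refl) | yes (j , refl) = begin
    arc G (a i) (a j)                   ≡⟨ CG.corner-arcs i j ⟩
    c3 i j                              ≡⟨ CH.corner-arcs i j ⟨
    arc H (b i) (b j)                   ≡⟨ cong₂ (arc H) (σ-corner i) (σ-corner j) ⟨
    arc H (σ ⟨$⟩ʳ a i) (σ ⟨$⟩ʳ a j)     ∎
    where open ≡-Reasoning
  ... | no ¬on | _      = agree-off-core (inj₁ (off-core ¬on))
  ... | _      | no ¬on = agree-off-core (inj₂ (off-core ¬on))

  cores⇒≅ : G ≅ H
  cores⇒≅ = σ , arcs-agree

-- Dicritical digraphs on k + 1 vertices have a triangle core

module _ {A : Set} (_≟ᴬ_ : (x y : A) → Dec (x ≡ y)) (R : A → A → Set)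
         (R-sym : ∀ {x y} → R x y → R y x) (R-irrefl : ∀ {x y} → R x y → x ≢ y)
         (intersecting : ∀ {a b c d} → R a b → R c d → a ≢ c → a ≢ d → b ≢ c → b ≢ d → ⊥)
         (unavoidable : ∀ x → ∃ λ p → ∃ λ q → R p q × p ≢ x × q ≢ x) where

  private
    partner : ∀ {x y} → R x y → ∃ λ z → R y z × z ≢ x
    partner {x} {y} Rxy with unavoidable x
    ... | p , q , Rpq , p≢x , q≢x with p ≟ᴬ y | q ≟ᴬ y
    ...   | yes refl | _        = q , Rpq , q≢x
    ...   | no _     | yes refl = p , R-sym Rpq , p≢x
    ...   | no p≢y   | no q≢y   =
      ⊥-elim (intersecting Rxy Rpq (≢-sym p≢x) (≢-sym q≢x) (≢-sym p≢y) (≢-sym q≢y))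

  intersecting-unavoidable⇒triangle : A → ∃ λ x → ∃ λ y → ∃ λ z → R x y × R y z × R x z
  intersecting-unavoidable⇒triangle a
    with x , y , Rxy , _ ← unavoidable a
    with z , Ryz , z≢x ← partner Rxy | z′ , Rxz′ , z′≢y ← partner (R-sym Rxy)
    with z ≟ᴬ z′
  ... | yes refl = x , y , z , Rxy , Ryz , Rxz′
  ... | no z≢z′  = ⊥-elim (intersecting Ryz Rxz′ (R-irrefl (R-sym Rxy)) (≢-sym z′≢y) z≢x z≢z′)

module _ {m : ℕ} (G : Digraph (3 + m)) (¬col : ¬ Dicolourable G (suc m)) where

  non-digon-pairs-intersect : ∀ {a b c d} → NonDigon G a b → NonDigon G c d →
    a ≢ c → a ≢ d → b ≢ c → b ≢ d → ⊥
  non-digon-pairs-intersect ab cd a≢c a≢d b≢c b≢d =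
    ¬col (disjoint-non-digon-pairs⇒dicolourable G ab cd a≢c a≢d b≢c b≢d)

  non-digon-triple⇒triangle : ∀ {x y z} → NonDigon G x y → NonDigon G y z → NonDigon G x z →
    Triangle G x y z ⊎ Triangle G x z y
  non-digon-triple⇒triangle xy yz xz with triangle-or-forward G xy yz xz
  ... | inj₁ xyz          = inj₁ xyz
  ... | inj₂ (inj₁ xzy)   = inj₂ xzy
  ... | inj₂ (inj₂ order) = ⊥-elim (¬col (forward-triple⇒dicolourable G order))

  triangle⇒core : ∀ {a b c} → NonDigon G a b → NonDigon G b c → NonDigon G a c →
    Triangle G a b c → TriangleCore G
  triangle⇒core {a} {b} {c} (a≢b , ¬ab↔) (b≢c , ¬bc↔) (a≢c , ¬ac↔) (ab , bc , ca) = record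
    { corner = corner ; corner-arcs = corner-arcs ; digon-off-core = digon-off-core }
    where
    corner : Fin 3 → Fin (3 + m)
    corner = a ∷ b ∷ c ∷ []
    corner-arcs : ∀ i j → arc G (corner i) (corner j) ≡ c3 i j
    corner-arcs 0F 0F = loopless G a
    corner-arcs 0F 1F = T⇒≡true ab
    corner-arcs 0F 2F = ¬T⇒≡false (¬Digon⇒¬reverse G ¬ac↔ ca)
    corner-arcs 1F 0F = ¬T⇒≡false (¬Digon⇒¬reverse G (¬ab↔ ∘ swap) ab)
    corner-arcs 1F 1F = loopless G b
    corner-arcs 1F 2F = T⇒≡true bc
    corner-arcs 2F 0F = T⇒≡true ca
    corner-arcs 2F 1F = ¬T⇒≡false (¬Digon⇒¬reverse G (¬bc↔ ∘ swap) bc)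
    corner-arcs 2F 2F = loopless G c
    digon-off-core : ∀ {u v} → u ≢ v → (∀ i → u ≢ corner i) → Digon G u v
    digon-off-core {u} {v} u≢v off with T? (arc G u v) ×-dec T? (arc G v u)
    ... | yes uv↔ = uv↔
    ... | no ¬uv↔ with v ≟ a | v ≟ b | v ≟ c
    ...   | yes refl | _        | _        =
      ⊥-elim (non-digon-pairs-intersect (u≢v , ¬uv↔) (b≢c , ¬bc↔) (off 1F) (off 2F) a≢b a≢c)
    ...   | no _     | yes refl | _        =
      ⊥-elim (non-digon-pairs-intersect (u≢v , ¬uv↔) (a≢c , ¬ac↔) (off 0F) (off 2F) (≢-sym a≢b) b≢c)
    ...   | no _     | no _     | yes refl =
      ⊥-elim (non-digon-pairs-intersect (u≢v , ¬uv↔) (a≢b , ¬ab↔) (off 0F) (off 1F) (≢-sym a≢c) (≢-sym b≢c))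
    ...   | no v≢a   | no v≢b   | no _     =
      ⊥-elim (non-digon-pairs-intersect (u≢v , ¬uv↔) (a≢b , ¬ab↔) (off 0F) (off 1F) v≢a v≢b)

module _ {m : ℕ} (G : Digraph (3 + m)) (critical : Dicritical G (2 + m)) where

  private
    ¬col : ¬ Dicolourable G (suc m)
    ¬col = proj₂ (proj₁ critical) (suc m) (ℕ.n<1+n _)

  -- By criticality G - x is (m + 1)-dicolourable, so not all of its pairs are digons.
  non-digon-pair-avoiding : ∀ x → ∃ λ p → ∃ λ q → NonDigon G p q × p ≢ x × q ≢ x
  non-digon-pair-avoiding x with j , (col-j , _) , j<2+m ← proj₂ critical (deleteVertex G x) (inj₁ (ℕ.n<1+n _)) =
    let u , v , u≢v , ¬uv↔ = dicolourable⇒non-digon-pair H (Dicolourable-mono H (ℕ.≤-pred j<2+m) col-j)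
    in punchIn x u , punchIn x v , (u≢v ∘ Fin.punchIn-injective x u v , ¬uv↔) ,
       Fin.punchInᵢ≢i x u , Fin.punchInᵢ≢i x v
    where
    H : Digraph (2 + m)
    H = Subdigraph.H (deleteVertex G x)

  dicritical⇒core : TriangleCore G
  dicritical⇒core = core-of-triple non-digon-triple
    where
    NonDigonTriple : Set
    NonDigonTriple = ∃ λ x → ∃ λ y → ∃ λ z → NonDigon G x y × NonDigon G y z × NonDigon G x z
    non-digon-triple : NonDigonTriple
    non-digon-triple = intersecting-unavoidable⇒triangle _≟_ (NonDigon G) (NonDigon-sym G) proj₁
                         (non-digon-pairs-intersect G ¬col) non-digon-pair-avoiding zero
    core-of-triple : NonDigonTriple → TriangleCore G
    core-of-triple (x , y , z , xy , yz , xz) with non-digon-triple⇒triangle G ¬col xy yz xz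
    ... | inj₁ xyz = triangle⇒core G ¬col xy yz xz xyz
    ... | inj₂ xzy = triangle⇒core G ¬col xz (NonDigon-sym G yz) xy xzy

-- K2(K_m, C3) is (m + 2)-dicritical

module _ {m : ℕ} where

  private
    K : Digraph (3 + m)
    K = K2KC3 m

  K-clique-digon : ∀ j v → 3+ j ≢ v → Digon K (3+ j) v
  K-clique-digon j 0F     _  = _
  K-clique-digon j 1F     _  = _
  K-clique-digon j 2F     _  = _
  K-clique-digon j (3+ i) ≢v = fromWitnessFalse ≢v , fromWitnessFalse (≢v ∘ sym)

  K-core : TriangleCore K
  K-core = record { corner = _↑ˡ m ; corner-arcs = corner-arcs ; digon-off-core = digon-off-core }
    where
    corner-arcs : ∀ i j → arc K (i ↑ˡ m) (j ↑ˡ m) ≡ c3 i j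
    corner-arcs i j rewrite Fin.splitAt-↑ˡ 3 i m | Fin.splitAt-↑ˡ 3 j m = refl
    digon-off-core : ∀ {u v} → u ≢ v → (∀ i → u ≢ i ↑ˡ m) → Digon K u v
    digon-off-core {0F}   _   off = contradiction refl (off 0F)
    digon-off-core {1F}   _   off = contradiction refl (off 1F)
    digon-off-core {2F}   _   off = contradiction refl (off 2F)
    digon-off-core {3+ j} u≢v _   = K-clique-digon j _ u≢v

  -- One of the arcs 0 → 1, 1 → 2 is bichromatic; dropping the third vertex of the 3-cycle
  -- leaves m + 2 vertices with pairwise distinct colours.
  ¬K-dicolourable : ¬ Dicolourable K (suc m)
  ¬K-dicolourable (c , dicolouring) = case-split (c 0F ≟ c 1F) (c 1F ≟ c 2F)
    where
    clique-separates : ∀ j v → c (3+ j) ≡ c v → 3+ j ≡ v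
    clique-separates j v same with 3+ j ≟ v
    ... | yes eq = eq
    ... | no  ne = ⊥-elim (digon-separates {c = c} dicolouring ne (K-clique-digon j v ne) same)
    too-many-colours : (e : Fin (2 + m) → Fin (3 + m)) → Injective _≡_ _≡_ e →
      (∀ j → e (2+ j) ≡ 3+ j) → c (e 0F) ≢ c (e 1F) → ⊥
    too-many-colours e e-inj e-clique c0≢c1 = ℕ.<-irrefl refl (Fin.injective⇒≤ colours-injective)
      where
      by-clique : ∀ j i → c (e (2+ j)) ≡ c (e i) → 2+ j ≡ i
      by-clique j i same =
        e-inj (trans (e-clique j) (clique-separates j (e i) (trans (cong c (sym (e-clique j))) same)))
      colours-injective : Injective _≡_ _≡_ (c ∘ e)
      colours-injective {0F}   {0F}   _    = refl
      colours-injective {1F}   {1F}   _    = refl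
      colours-injective {0F}   {1F}   same = contradiction same c0≢c1
      colours-injective {1F}   {0F}   same = contradiction (sym same) c0≢c1
      colours-injective {2+ j} {i}    same = by-clique j i same
      colours-injective {i}    {2+ j} same = sym (by-clique j i (sym same))
    case-split : Dec (c 0F ≡ c 1F) → Dec (c 1F ≡ c 2F) → ⊥
    case-split (no c0≢c1) _ =
      too-many-colours (punchIn 2F) (Fin.punchIn-injective 2F _ _) (λ _ → refl) c0≢c1
    case-split (yes _) (no c1≢c2) =
      too-many-colours (punchIn 0F) (Fin.punchIn-injective 0F _ _) (λ _ → refl) c1≢c2
    case-split (yes c0≡c1) (yes c1≡c2) =
      triangle-separates {c = c} dicolouring {0F} {1F} {2F} (λ ()) (λ ()) (λ ()) _ c0≡c1 c1≡c2

  K-successor : ∀ w → ∃ λ v → T (arc K w v)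
  K-successor 0F     = 1F , _
  K-successor 1F     = 2F , _
  K-successor 2F     = 0F , _
  K-successor (3+ j) = 0F , proj₁ (K-clique-digon j 0F (λ ()))

  private
    disjoint-from-deleted-arc : ∀ {u v} p q → T (arc K u v) → p ≢ q → u ≢ p → u ≢ q → v ≢ p → v ≢ q →
      ¬ Digon K p q → Dicolourable (deleteArc K u v) (suc m)
    disjoint-from-deleted-arc {u} {v} p q uv p≢q u≢p u≢q v≢p v≢q ¬pq↔ =
      disjoint-non-digon-pairs⇒dicolourable (deleteArc K u v)
        (arc⇒≢ K uv , deleteArc-deletes K {u} {v} ∘ proj₁) (p≢q , ¬Digon-deleteArc K {u} {v} {p} {q} ¬pq↔)
        u≢p u≢q v≢p v≢q

  -- Deleting an arc of the 3-cycle makes it orderable; deleting any other arc uv makes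
  -- {u, v} a non-digon pair disjoint from a pair of the 3-cycle.
  K-deleteArc-dicolourable : ∀ u v → T (arc K u v) → Dicolourable (deleteArc K u v) (suc m)
  K-deleteArc-dicolourable 0F 1F _ =
    forward-triple⇒dicolourable (deleteArc K 0F 1F)
      (forward-triple 1F 2F 0F (λ ()) (λ ()) (λ ()) (λ ()) (λ ()) (λ ()))
  K-deleteArc-dicolourable 1F 2F _ =
    forward-triple⇒dicolourable (deleteArc K 1F 2F)
      (forward-triple 2F 0F 1F (λ ()) (λ ()) (λ ()) (λ ()) (λ ()) (λ ()))
  K-deleteArc-dicolourable 2F 0F _ =
    forward-triple⇒dicolourable (deleteArc K 2F 0F)
      (forward-triple 0F 1F 2F (λ ()) (λ ()) (λ ()) (λ ()) (λ ()) (λ ()))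
  K-deleteArc-dicolourable (3+ i) 0F uv =
    disjoint-from-deleted-arc 1F 2F uv (λ ()) (λ ()) (λ ()) (λ ()) (λ ()) λ { (_ , ()) }
  K-deleteArc-dicolourable (3+ i) 1F uv =
    disjoint-from-deleted-arc 0F 2F uv (λ ()) (λ ()) (λ ()) (λ ()) (λ ()) λ { (() , _) }
  K-deleteArc-dicolourable (3+ i) 2F uv =
    disjoint-from-deleted-arc 0F 1F uv (λ ()) (λ ()) (λ ()) (λ ()) (λ ()) λ { (_ , ()) }
  K-deleteArc-dicolourable (3+ i) (3+ j) uv =
    disjoint-from-deleted-arc 0F 1F uv (λ ()) (λ ()) (λ ()) (λ ()) (λ ()) λ { (_ , ()) }
  K-deleteArc-dicolourable 0F (3+ j) uv =
    disjoint-from-deleted-arc 1F 2F uv (λ ()) (λ ()) (λ ()) (λ ()) (λ ()) λ { (_ , ()) }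
  K-deleteArc-dicolourable 1F (3+ j) uv =
    disjoint-from-deleted-arc 0F 2F uv (λ ()) (λ ()) (λ ()) (λ ()) (λ ()) λ { (() , _) }
  K-deleteArc-dicolourable 2F (3+ j) uv =
    disjoint-from-deleted-arc 0F 1F uv (λ ()) (λ ()) (λ ()) (λ ()) (λ ()) λ { (_ , ()) }
  K-deleteArc-dicolourable 0F 0F ()
  K-deleteArc-dicolourable 0F 2F ()
  K-deleteArc-dicolourable 1F 0F ()
  K-deleteArc-dicolourable 1F 1F ()
  K-deleteArc-dicolourable 2F 1F ()
  K-deleteArc-dicolourable 2F 2F ()

  K-dicritical : Dicritical K (2 + m)
  K-dicritical = (colourable , lower-bound) , critical
    where
    colourable : Dicolourable K (2 + m)
    colourable = non-digon-pair⇒dicolourable K {0F} {1F} ((λ ()) , λ { (_ , ()) })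
    lower-bound : ∀ j → j < 2 + m → ¬ Dicolourable K j
    lower-bound j j<2+m = ¬K-dicolourable ∘ Dicolourable-mono K (ℕ.≤-pred j<2+m)
    critical : ∀ S → Proper S → ∃ λ j → HasDichromaticNumber (Subdigraph.H S) j × j < 2 + m
    critical S proper with u , v , uv , avoids ← proper⇒avoids-arc K S K-successor proper =
      let j , χ , j≤1+m = dichromatic-number-≤ H (Dicolourable-pullback H (deleteArc K u v) emb embInj
                            (embeds-into-deleteArc K S avoids) (K-deleteArc-dicolourable u v uv))
      in j , χ , ℕ.s≤s j≤1+m
      where open Subdigraph S

transport-dicritical : {G G′ : Digraph n} → G ≅ G′ → Dicritical G′ k → Dicritical G k
transport-dicritical {k = k} {G} {G′} (σ , σ-arcs) ((col , lower) , critical) =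
  (pull-to col , λ j j<k → lower j j<k ∘ pull-from) , critical′
  where
  open Inverse σ using (to; from; strictlyInverseˡ)
  to-injective : Injective _≡_ _≡_ to
  to-injective = Injection.injective (↔⇒↣ σ)
  from-injective : Injective _≡_ _≡_ from
  from-injective = Injection.injective (↔⇒↣ (↔-sym σ))
  arc-to : ∀ u v → T (arc G u v) → T (arc G′ (to u) (to v))
  arc-to u v = subst T (σ-arcs u v)
  arc-from : ∀ u v → T (arc G′ u v) → T (arc G (from u) (from v))
  arc-from u v = subst T (sym (trans (σ-arcs (from u) (from v))
                                     (cong₂ (arc G′) (strictlyInverseˡ u) (strictlyInverseˡ v))))
  pull-to : ∀ {j} → Dicolourable G′ j → Dicolourable G j
  pull-to = Dicolourable-pullback G G′ to to-injective arc-to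
  pull-from : ∀ {j} → Dicolourable G j → Dicolourable G′ j
  pull-from = Dicolourable-pullback G′ G from from-injective arc-from
  critical′ : ∀ S → Proper S → ∃ λ j → HasDichromaticNumber (Subdigraph.H S) j × j < k
  critical′ S proper = critical S′ (proper′ proper)
    where
    open Subdigraph S using (emb; embInj; arcsIn)
    S′ : Subdigraph G′
    S′ = record { H = Subdigraph.H S ; emb = to ∘ emb ; embInj = embInj ∘ to-injective
                ; arcsIn = λ u v → arc-to _ _ ∘ arcsIn u v }
    proper′ : Proper S → Proper S′
    proper′ (inj₁ fewer)              = inj₁ fewer
    proper′ (inj₂ (u , v , uv , ¬uv)) = inj₂ (u , v , arc-to _ _ uv , ¬uv)

lemma3p5 : (m : ℕ) (G : Digraph (suc (suc (suc m)))) →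
    Dicritical G (suc (suc m)) ⇔ (G ≅ K2KC3 m)
lemma3p5 m G = mk⇔ (λ critical → cores⇒≅ (dicritical⇒core G critical) K-core)
                   (λ G≅K → transport-dicritical G≅K K-dicritical)
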